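{- Let $\mathscr{C}$ be a pyramidal set system on a finite set $V$. Then $\mathscr{C}$ satisfies (P3): for all $A,B,C,D\in\mathscr{C}$, if $A\between B$, $B\between C$, $B\between D$ and $A\cup C\subseteq D$, then $A\cap C\neq\emptyset$.
   Context: A set system (clustering system) $\mathscr{C}$ of non-empty subsets of $V$ is pyramidal if it is closed under non-empty intersections (if $A,B\in\mathscr{C}$ and $A\cap B\neq\emptyset$ then $A\cap B\in\mathscr{C}$) and there is a total order $<$ on $V$ such that every $C\in\mathscr{C}$ is an interval w.r.t. $<$ (if $x,y\in C$ and $x<u<y$ then $u\in C$). Sets $A,B$ overlap, $A\between B$, if $A\cap B$, $A\setminus B$, $B\setminus A$ are all non-empty. -}

module Defs where

open import Data.Nat using (ℕ)
open import Data.Fin using (Fin; _<_)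
open import Data.Fin.Subset using (Subset; _∈_; _⊆_; _∩_; _∪_; _─_; Nonempty)
open import Data.Fin.Permutation using (Permutation′; _⟨$⟩ʳ_)
open import Data.List using (List)
import Data.List.Membership.Propositional as L
open import Data.Product using (_×_; ∃)

SetSystem : ℕ → Set
SetSystem n = List (Subset n)

_∈ˢ_ : ∀ {n} → Subset n → SetSystem n → Set
A ∈ˢ 𝒞 = A L.∈ 𝒞

AllNonempty : ∀ {n} → SetSystem n → Set
AllNonempty 𝒞 = ∀ A → A ∈ˢ 𝒞 → Nonempty A

IntersectionClosed : ∀ {n} → SetSystem n → Set
IntersectionClosed 𝒞 = ∀ A B → A ∈ˢ 𝒞 → B ∈ˢ 𝒞 → Nonempty (A ∩ B) → (A ∩ B) ∈ˢ 𝒞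

-- A total order on Fin n is represented by a permutation π:
-- x precedes y iff π x < π y.  C is an interval w.r.t. this order.
IsInterval : ∀ {n} → Permutation′ n → Subset n → Set
IsInterval π C = ∀ x y u → x ∈ C → y ∈ C →
  (π ⟨$⟩ʳ x) < (π ⟨$⟩ʳ u) → (π ⟨$⟩ʳ u) < (π ⟨$⟩ʳ y) → u ∈ C

Pyramidal : ∀ {n} → SetSystem n → Set
Pyramidal {n} 𝒞 = AllNonempty 𝒞 × IntersectionClosed 𝒞 ×
  ∃ λ (π : Permutation′ n) → ∀ C → C ∈ˢ 𝒞 → IsInterval π C

_≬_ : ∀ {n} → Subset n → Subset n → Set
A ≬ B = Nonempty (A ∩ B) × Nonempty (A ─ B) × Nonempty (B ─ A)

P3 : ∀ {n} → SetSystem n → Set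
P3 𝒞 = ∀ A B C D → A ∈ˢ 𝒞 → B ∈ˢ 𝒞 → C ∈ˢ 𝒞 → D ∈ˢ 𝒞 →
  A ≬ B → B ≬ C → B ≬ D → (A ∪ C) ⊆ D → Nonempty (A ∩ C)

{-# OPTIONS --safe #-}
module Submission where

-- Pick a ∈ A ∖ B, c ∈ C ∖ B and
-- x ∈ B ∖ D.  Since a, c ∈ D and D is an interval avoiding x, the points a
-- and c lie on the same side of x, say below it.  An interval B containing x
-- but not c, with c below x, lies entirely above c; the same holds for a.
-- So if a ≤ c then c lies between a and a point of A ∩ B, hence c ∈ A ∩ C;
-- symmetrically if c ≤ a then a ∈ A ∩ C.

open import Defs
open import Data.Nat using (ℕ)
open import Data.Fin using (Fin; _<_)
open import Data.Fin.Properties using (<-cmp)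
open import Data.Fin.Subset using (Subset; _∈_; _∉_; _─_; outside)
open import Data.Fin.Subset.Properties using (x∈p∩q⁺; x∈p∩q⁻; p─q⊆p; p⊆p∪q; q⊆p∪q)
open import Data.Fin.Permutation using (Permutation′; _⟨$⟩ʳ_)
open import Data.Vec using (_∷_; here; there)
open import Data.Product using (∃; _×_; _,_)
open import Data.Sum using (_⊎_; inj₁; inj₂)
open import Function using (_∘_; flip)
open import Function.Bundles using (Injection)
open import Function.Properties.Inverse using (↔⇒↣)
open import Level using (Level; _⊔_; 0ℓ)
open import Relation.Binary.Core using (Rel)
open import Relation.Binary.Definitions using (Trichotomous; tri<; tri≈; tri>)
open import Relation.Binary.PropositionalEquality using (_≡_; refl; cong)
import Relation.Binary.Construct.Flip.EqAndOrd as Flip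
open import Relation.Nullary using (¬_; contradiction)
open import Relation.Unary using (Pred)

private
  variable
    a ℓ ℓ′ : Level
    A : Set a

x∈p─q⇒x∉q : ∀ {n} {p q : Subset n} {x} → x ∈ p ─ q → x ∉ q
x∈p─q⇒x∉q {p = _ ∷ _} {outside ∷ _} here ()
x∈p─q⇒x∉q {p = _ ∷ _} {_ ∷ _} (there x∈p─q) (there x∈q) = x∈p─q⇒x∉q x∈p─q x∈q

Convex : {A : Set a} → Rel A ℓ → Pred A ℓ′ → Set (a ⊔ ℓ ⊔ ℓ′)
Convex _≺_ P = ∀ x y u → P x → P y → x ≺ u → u ≺ y → P u

convex-flip : ∀ {_≺_ : Rel A ℓ} {P : Pred A ℓ′} → Convex _≺_ P → Convex (flip _≺_) P
convex-flip convex x y u x∈P y∈P u≺x y≺u = convex y x u y∈P x∈P y≺u u≺x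

module Convexity {_≺_ : Rel A ℓ} (compare : Trichotomous _≡_ _≺_) where

  below-one⇒below-all : ∀ {P : Pred A ℓ′} {c x y} → Convex _≺_ P →
    ¬ P c → P x → c ≺ x → P y → c ≺ y
  below-one⇒below-all {c = c} {x} {y} convex c∉P x∈P c≺x y∈P with compare c y
  ... | tri< c≺y _ _ = c≺y
  ... | tri≈ _ refl _ = contradiction y∈P c∉P
  ... | tri> _ _ y≺c = contradiction (convex y x c y∈P x∈P y≺c c≺x) c∉P

  same-side-of-gap : ∀ {P : Pred A ℓ′} {a c x} → Convex _≺_ P →
    P a → P c → ¬ P x → (a ≺ x × c ≺ x) ⊎ (x ≺ a × x ≺ c)
  same-side-of-gap {a = a} {c} {x} convex a∈P c∈P x∉P with compare a x | compare c x
  ... | tri≈ _ refl _ | _             = contradiction a∈P x∉P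
  ... | _             | tri≈ _ refl _ = contradiction c∈P x∉P
  ... | tri< a≺x _ _  | tri< c≺x _ _  = inj₁ (a≺x , c≺x)
  ... | tri< a≺x _ _  | tri> _ _ x≺c  = contradiction (convex a c x a∈P c∈P a≺x x≺c) x∉P
  ... | tri> _ _ x≺a  | tri< c≺x _ _  = contradiction (convex c a x c∈P a∈P c≺x x≺a) x∉P
  ... | tri> _ _ x≺a  | tri> _ _ x≺c  = inj₂ (x≺a , x≺c)

  meet-of-overlaps-below : ∀ {P Q R : Pred A ℓ′} {a c p q x} →
    Convex _≺_ P → Convex _≺_ Q → Convex _≺_ R →
    P a → ¬ Q a → R c → ¬ Q c → P p → Q p → R q → Q q →
    Q x → a ≺ x → c ≺ x → ∃ λ u → P u × R u
  meet-of-overlaps-below {a = a} {c} {p} {q} convexP convexQ convexR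
    a∈P a∉Q c∈R c∉Q p∈P p∈Q q∈R q∈Q x∈Q a≺x c≺x with compare a c
  ... | tri< a≺c _ _  =
    c , convexP a p c a∈P p∈P a≺c (below-one⇒below-all convexQ c∉Q x∈Q c≺x p∈Q) , c∈R
  ... | tri≈ _ refl _ = a , a∈P , c∈R
  ... | tri> _ _ c≺a  =
    a , a∈P , convexR c q a c∈R q∈R c≺a (below-one⇒below-all convexQ a∉Q x∈Q a≺x q∈Q)

meet-of-overlaps : ∀ {_≺_ : Rel A ℓ} → Trichotomous _≡_ _≺_ →
  ∀ {P Q R S : Pred A ℓ′} {a c p q x} →
  Convex _≺_ P → Convex _≺_ Q → Convex _≺_ R → Convex _≺_ S →
  P a → ¬ Q a → R c → ¬ Q c → P p → Q p → R q → Q q →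
  Q x → ¬ S x → S a → S c → ∃ λ u → P u × R u
meet-of-overlaps {_≺_ = _≺_} compare cP cQ cR cS
  a∈P a∉Q c∈R c∉Q p∈P p∈Q q∈R q∈Q x∈Q x∉S a∈S c∈S
  with Convexity.same-side-of-gap compare cS a∈S c∈S x∉S
... | inj₁ (a≺x , c≺x) =
  Convexity.meet-of-overlaps-below compare cP cQ cR
    a∈P a∉Q c∈R c∉Q p∈P p∈Q q∈R q∈Q x∈Q a≺x c≺x
... | inj₂ (x≺a , x≺c) =
  Convexity.meet-of-overlaps-below (Flip.compare _≺_ compare)
    (convex-flip cP) (convex-flip cQ) (convex-flip cR)
    a∈P a∉Q c∈R c∉Q p∈P p∈Q q∈R q∈Q x∈Q x≺a x≺c

module _ {n : ℕ} (π : Permutation′ n) where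

  _≺ᵖ_ : Rel (Fin n) 0ℓ
  x ≺ᵖ y = (π ⟨$⟩ʳ x) < (π ⟨$⟩ʳ y)

  ≺ᵖ-compare : Trichotomous _≡_ _≺ᵖ_
  ≺ᵖ-compare x y with <-cmp (π ⟨$⟩ʳ x) (π ⟨$⟩ʳ y)
  ... | tri< x≺y x≢y y⊀x = tri< x≺y (x≢y ∘ cong (π ⟨$⟩ʳ_)) y⊀x
  ... | tri≈ x⊀y x≡y y⊀x = tri≈ x⊀y (Injection.injective (↔⇒↣ π) x≡y) y⊀x
  ... | tri> x⊀y x≢y y≺x = tri> x⊀y (x≢y ∘ cong (π ⟨$⟩ʳ_)) y≺x

mainTheorem18 : (n : ℕ) → (𝒞 : SetSystem n) → Pyramidal 𝒞 → P3 𝒞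
mainTheorem18 n 𝒞 (_ , _ , π , intervals) A B C D A∈𝒞 B∈𝒞 C∈𝒞 D∈𝒞
  ((p , p∈A∩B) , (a , a∈A─B) , _) ((q , q∈B∩C) , _ , (c , c∈C─B)) (_ , (x , x∈B─D) , _) A∪C⊆D
  = let p∈A , p∈B       = x∈p∩q⁻ A B p∈A∩B
        q∈B , q∈C       = x∈p∩q⁻ B C q∈B∩C
        a∈A             = p─q⊆p A B a∈A─B
        c∈C             = p─q⊆p C B c∈C─B
        u , u∈A , u∈C   = meet-of-overlaps (≺ᵖ-compare π)
          (intervals A A∈𝒞) (intervals B B∈𝒞) (intervals C C∈𝒞) (intervals D D∈𝒞)
          a∈A (x∈p─q⇒x∉q a∈A─B) c∈C (x∈p─q⇒x∉q c∈C─B) p∈A p∈B q∈C q∈B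
          (p─q⊆p B D x∈B─D) (x∈p─q⇒x∉q x∈B─D)
          (A∪C⊆D (p⊆p∪q C a∈A)) (A∪C⊆D (q⊆p∪q A C c∈C))
    in u , x∈p∩q⁺ (u∈A , u∈C)
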